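{- Let $n$ be even, $r=v_2(n)$ and $m=n/2^r$. Let $B$ be the set of all odd elements of $\mathbb{Z}_n$ and let $A$ satisfy $\{m\}\subseteq A\subseteq B$. Then $C_A(n)=2^r$.
   Context: $v_2(n)=r$ means $2^r\mid n$ and $2^{r+1}\nmid n$. $\mathbb{Z}_n=\mathbb{Z}/n\mathbb{Z}$; for $n$ even, an element is odd if its integer representatives are odd. For $A\subseteq\mathbb{Z}_n$, an $A$-weighted zero-sum subsequence of consecutive terms of a sequence $(x_1,\ldots,x_k)$ in $\mathbb{Z}_n$ is given by a non-empty set $I\subseteq[1,k]$ of consecutive integers and $a_i\in A$ ($i\in I$) with $\sum_{i\in I}a_ix_i=0$. $C_A(n)$ is the least positive integer $k$ such that every sequence of length $k$ in $\mathbb{Z}_n$ has such a subsequence. -}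

module Defs where

open import Data.Nat using (ℕ; zero; suc; _+_; _*_; _^_; _≤_; _<_; NonZero)
open import Data.Nat.DivMod using (_%_)
open import Data.Fin using (Fin; toℕ)
open import Data.Product using (Σ; ∃; _×_; _,_)
open import Relation.Binary.PropositionalEquality using (_≡_)
open import Relation.Nullary using (¬_)

-- Elements of ℤ_n are represented by Fin n (canonical representatives 0..n-1).
-- A subset of ℤ_n is a predicate on Fin n.
Subset : ℕ → Set₁
Subset n = Fin n → Set

OddElem : {n : ℕ} → Fin n → Set
OddElem x = toℕ x % 2 ≡ 1

open import Data.Nat.Divisibility using (_∣_)
V2 : ℕ → ℕ → Set
V2 n r = (2 ^ r ∣ n) × ¬ (2 ^ suc r ∣ n)

sumFrom : (f : ℕ → ℕ) → (i len : ℕ) → ℕ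
sumFrom f i zero = f i
sumFrom f i (suc len) = f i + sumFrom f (suc i) len

-- extend a finite sequence to ℕ by 0 outside its domain (only used on indices inside)
open import Data.Fin using (fromℕ<)
open import Data.Nat using (_<?_)
open import Relation.Nullary using (yes; no)

at : {k n : ℕ} → (Fin k → Fin n) → ℕ → ℕ
at {k} s t with t <? k
... | yes p = toℕ (s (fromℕ< p))
... | no _ = 0

HasAZeroSumConsec : (n : ℕ) .{{_ : NonZero n}} → Subset n → (k : ℕ) → (Fin k → Fin n) → Set
HasAZeroSumConsec n A k x =
  Σ ℕ λ i → Σ ℕ λ len → (i + len < k) ×
  Σ (Fin k → Fin n) λ a →
    ((t : Fin k) → i ≤ toℕ t → toℕ t ≤ i + len → A (a t)) ×
    (sumFrom (λ t → at a t * at x t) i len % n ≡ 0)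

AllHave : (n : ℕ) .{{_ : NonZero n}} → Subset n → ℕ → Set
AllHave n A k = (x : Fin k → Fin n) → HasAZeroSumConsec n A k x

IsCA : (n : ℕ) .{{_ : NonZero n}} → Subset n → ℕ → Set
IsCA n A c = (1 ≤ c) × AllHave n A c × ((k : ℕ) → 1 ≤ k → AllHave n A k → c ≤ k)

-- Upper bound: among the 2^r + 1 prefix sums of a sequence of length 2^r two agree modulo 2^r,
-- so some block of consecutive terms has a sum S with 2^r ∣ S, and weighting every term by m
-- gives the sum m S ≡ 0 (mod n).
-- Lower bound: for k < 2^r take the ruler sequence x_t = 2^(r-1-v₂(t)), t = 1, …, k.  In every
-- block of consecutive indices exactly one index has the largest 2-adic valuation, so exactly
-- one term of an odd-weighted block sum is an odd multiple of some 2^e with e < r, while all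
-- the others are divisible by 2^(e+1); hence 2^(e+1) ∤ S, and S ≢ 0 (mod n) since 2^(e+1) ∣ n.
module Submission where

open import Defs
open import Data.Nat
open import Data.Nat.Properties
open import Data.Nat.DivMod
open import Data.Nat.Divisibility
open import Data.Fin using (Fin; toℕ; fromℕ<)
open import Data.Fin.Properties using (toℕ-fromℕ<; toℕ<n; pigeonhole)
open import Data.Product
open import Function using (_∘_)
open import Relation.Nullary
open import Relation.Binary.PropositionalEquality
open import Relation.Binary.Definitions using (tri<; tri≈; tri>)

at-< : ∀ {k n} (s : Fin k → Fin n) {t} (t<k : t < k) → at s t ≡ toℕ (s (fromℕ< t<k))
at-< {k} s {t} t<k with t <? k
... | yes _ = refl
... | no t≮k = contradiction t<k t≮k

tail⊆block : ∀ {i len t} → suc i ≤ t → t ≤ suc i + len → i ≤ t × t ≤ i + suc len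
tail⊆block {i} {len} i<t t≤ = ≤-trans (n≤1+n i) i<t , ≤-trans t≤ (≤-reflexive (sym (+-suc i len)))

sumFrom-cong : ∀ (f g : ℕ → ℕ) i len →
  (∀ t → i ≤ t → t ≤ i + len → f t ≡ g t) → sumFrom f i len ≡ sumFrom g i len
sumFrom-cong f g i zero f≗g = f≗g i ≤-refl (≤-reflexive (sym (+-identityʳ i)))
sumFrom-cong f g i (suc len) f≗g = cong₂ _+_ (f≗g i ≤-refl (m≤m+n i _))
  (sumFrom-cong f g (suc i) len (λ t i<t t≤ → uncurry (f≗g t) (tail⊆block i<t t≤)))

sumFrom-*ˡ : ∀ c (g : ℕ → ℕ) i len → sumFrom (λ t → c * g t) i len ≡ c * sumFrom g i len
sumFrom-*ˡ c g i zero = refl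
sumFrom-*ˡ c g i (suc len) =
  trans (cong (c * g i +_) (sumFrom-*ˡ c g (suc i) len)) (sym (*-distribˡ-+ c (g i) _))

∣-sumFrom : ∀ d (f : ℕ → ℕ) i len →
  (∀ t → i ≤ t → t ≤ i + len → d ∣ f t) → d ∣ sumFrom f i len
∣-sumFrom d f i zero d∣f = d∣f i ≤-refl (≤-reflexive (sym (+-identityʳ i)))
∣-sumFrom d f i (suc len) d∣f = ∣m∣n⇒∣m+n (d∣f i ≤-refl (m≤m+n i _))
  (∣-sumFrom d f (suc i) len (λ t i<t t≤ → uncurry (d∣f t) (tail⊆block i<t t≤)))

∤-sumFrom : ∀ d (f : ℕ → ℕ) c i len → i ≤ c → c ≤ i + len →
  (∀ t → i ≤ t → t ≤ i + len → t ≢ c → d ∣ f t) → ¬ d ∣ f c → ¬ d ∣ sumFrom f i len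
∤-sumFrom d f c i zero i≤c c≤i d∣f d∤fc with ≤-antisym i≤c (subst (c ≤_) (+-identityʳ i) c≤i)
... | refl = d∤fc
∤-sumFrom d f c i (suc len) i≤c c≤ d∣f d∤fc d∣sum with i ≟ c
... | yes refl = d∤fc (∣m+n∣m⇒∣n (subst (d ∣_) (+-comm (f i) _) d∣sum)
      (∣-sumFrom d f (suc i) len λ t i<t t≤ →
        uncurry (d∣f t) (tail⊆block i<t t≤) (λ t≡i → <⇒≢ i<t (sym t≡i))))
... | no i≢c = ∤-sumFrom d f c (suc i) len (≤∧≢⇒< i≤c i≢c) (≤-trans c≤ (≤-reflexive (+-suc i len)))
      (λ t i<t t≤ → uncurry (d∣f t) (tail⊆block i<t t≤)) d∤fc
      (∣m+n∣m⇒∣n d∣sum (d∣f i ≤-refl (m≤m+n i _) i≢c))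

prefixSum : (ℕ → ℕ) → ℕ → ℕ
prefixSum g zero = 0
prefixSum g (suc j) = prefixSum g j + g j

prefixSum-+-sumFrom : ∀ g i len → prefixSum g i + sumFrom g i len ≡ prefixSum g (suc (i + len))
prefixSum-+-sumFrom g i zero rewrite +-identityʳ i = refl
prefixSum-+-sumFrom g i (suc len) = begin
  prefixSum g i + (g i + sumFrom g (suc i) len) ≡⟨ +-assoc (prefixSum g i) (g i) _ ⟨
  prefixSum g (suc i) + sumFrom g (suc i) len   ≡⟨ prefixSum-+-sumFrom g (suc i) len ⟩
  prefixSum g (suc (suc i + len))               ≡⟨ cong (prefixSum g ∘ suc) (+-suc i len) ⟨
  prefixSum g (suc (i + suc len))               ∎
  where open ≡-Reasoning

[m+n]%d≡m%d⇒d∣n : ∀ m n d .{{_ : NonZero d}} → (m + n) % d ≡ m % d → d ∣ n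
[m+n]%d≡m%d⇒d∣n m n d eq = ∣m+n∣m⇒∣n (divides ((m + n) / d) (+-cancelˡ-≡ (m % d) _ _ split))
                                       (n∣m*n (m / d))
  where
  open ≡-Reasoning
  split : m % d + (m / d * d + n) ≡ m % d + (m + n) / d * d
  split = begin
    m % d + (m / d * d + n)       ≡⟨ +-assoc (m % d) _ n ⟨
    m % d + m / d * d + n         ≡⟨ cong (_+ n) (m≡m%n+[m/n]*n m d) ⟨
    m + n                         ≡⟨ m≡m%n+[m/n]*n (m + n) d ⟩
    (m + n) % d + (m + n) / d * d ≡⟨ cong (_+ (m + n) / d * d) eq ⟩
    m % d + (m + n) / d * d       ∎

blockSum-divisible : ∀ d .{{_ : NonZero d}} (g : ℕ → ℕ) →
  ∃₂ λ i len → i + len < d × d ∣ sumFrom g i len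
blockSum-divisible d g = toℕ i , len , i+len<d ,
  [m+n]%d≡m%d⇒d∣n (prefixSum g (toℕ i)) (sumFrom g (toℕ i) len) d
    (trans (cong (_% d) (trans (prefixSum-+-sumFrom g (toℕ i) len) (cong (prefixSum g) end≡j)))
           (sym prefixSums≡))
  where
  residue : Fin (suc d) → Fin d
  residue j = fromℕ< (m%n<n (prefixSum g (toℕ j)) d)
  collision = pigeonhole (n<1+n d) residue
  i = proj₁ collision
  j = proj₁ (proj₂ collision)
  i<j = proj₁ (proj₂ (proj₂ collision))
  len = toℕ j ∸ suc (toℕ i)
  end≡j : suc (toℕ i + len) ≡ toℕ j
  end≡j = m+[n∸m]≡n i<j
  i+len<d : toℕ i + len < d
  i+len<d = subst (_≤ d) (sym end≡j) (≤-pred (toℕ<n j))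
  prefixSums≡ : prefixSum g (toℕ i) % d ≡ prefixSum g (toℕ j) % d
  prefixSums≡ = begin
    prefixSum g (toℕ i) % d ≡⟨ toℕ-fromℕ< _ ⟨
    toℕ (residue i)         ≡⟨ cong toℕ (proj₂ (proj₂ (proj₂ collision))) ⟩
    toℕ (residue j)         ≡⟨ toℕ-fromℕ< _ ⟩
    prefixSum g (toℕ j) % d ∎
    where open ≡-Reasoning

allHave-constantWeight : ∀ n .{{_ : NonZero n}} (A : Subset n) (w : Fin n) → A w →
  ∀ d .{{_ : NonZero d}} → n ∣ toℕ w * d → AllHave n A d
allHave-constantWeight n A w w∈A d n∣wd x with blockSum-divisible d (at x)
... | i , len , i+len<d , d∣S = i , len , i+len<d , constant , (λ _ _ _ → w∈A) ,
  n∣m⇒m%n≡0 _ n (subst (n ∣_) (sym weightedSum≡) (∣-trans n∣wd (*-monoʳ-∣ (toℕ w) d∣S)))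
  where
  constant : Fin d → Fin n
  constant _ = w
  weightedSum≡ : sumFrom (λ t → at constant t * at x t) i len ≡ toℕ w * sumFrom (at x) i len
  weightedSum≡ = trans
    (sumFrom-cong _ _ i len λ t _ t≤ → cong (_* at x t) (at-< constant (≤-<-trans t≤ i+len<d)))
    (sumFrom-*ˡ (toℕ w) (at x) i len)

^-monoʳ-∣ : ∀ m {a b} → a ≤ b → m ^ a ∣ m ^ b
^-monoʳ-∣ m {a} {b} a≤b = divides (m ^ (b ∸ a)) (begin
  m ^ b               ≡⟨ cong (m ^_) (m+[n∸m]≡n a≤b) ⟨
  m ^ (a + (b ∸ a))   ≡⟨ ^-distribˡ-+-* m a (b ∸ a) ⟩
  m ^ a * m ^ (b ∸ a) ≡⟨ *-comm (m ^ a) _ ⟩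
  m ^ (b ∸ a) * m ^ a ∎)
  where open ≡-Reasoning

2^[1+e]∤odd*2^e : ∀ w e → w % 2 ≡ 1 → ¬ 2 ^ suc e ∣ w * 2 ^ e
2^[1+e]∤odd*2^e w e w-odd 2^[1+e]∣ with trans (sym (n∣m⇒m%n≡0 w 2 2∣w)) w-odd
  where 2∣w = *-cancelʳ-∣ (2 ^ e) {{m^n≢0 2 e}} 2^[1+e]∣
... | ()

record Peak (f : ℕ → ℕ) (i j e : ℕ) : Set where
  constructor peak
  field
    position : ℕ
    i≤position : i ≤ position
    position≤j : position ≤ j
    atPosition : f position ≡ 2 ^ e
    elsewhere : ∀ t → i ≤ t → t ≤ j → t ≢ position → 2 ^ suc e ∣ f t

peak-double : ∀ {f g i j e} → (∀ t → i ≤ t → t ≤ j → g t ≡ 2 * f t) →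
  Peak f i j e → Peak g i j (suc e)
peak-double {e = e} g≡2f (peak c i≤c c≤j fc≡ elsewhere) =
  peak c i≤c c≤j (trans (g≡2f c i≤c c≤j) (cong (2 *_) fc≡))
    λ t i≤t t≤j t≢c → subst (2 ^ suc (suc e) ∣_) (sym (g≡2f t i≤t t≤j))
                        (*-monoʳ-∣ 2 (elsewhere t i≤t t≤j t≢c))

peak-shift : ∀ {f i j e} h → Peak f i j e → Peak (λ t → f (t ∸ h)) (i + h) (j + h) e
peak-shift {f} h (peak c i≤c c≤j fc≡ elsewhere) =
  peak (c + h) (+-monoˡ-≤ h i≤c) (+-monoˡ-≤ h c≤j) (trans (cong f (m+n∸n≡m c h)) fc≡)
    λ t i+h≤t t≤j+h t≢c+h → elsewhere (t ∸ h)
      (subst (_≤ t ∸ h) (m+n∸n≡m _ h) (∸-monoˡ-≤ h i+h≤t))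
      (subst (t ∸ h ≤_) (m+n∸n≡m _ h) (∸-monoˡ-≤ h t≤j+h))
      λ t∸h≡c → t≢c+h (trans (sym (m∸n+n≡m (≤-trans (m≤n+m h _) i+h≤t))) (cong (_+ h) t∸h≡c))

peak-pred : ∀ {f i j e} → Peak f (suc i) (suc j) e → Peak (f ∘ suc) i j e
peak-pred (peak (suc c) (s≤s i≤c) (s≤s c≤j) fc≡ elsewhere) =
  peak c i≤c c≤j fc≡ λ t i≤t t≤j t≢c → elsewhere (suc t) (s≤s i≤t) (s≤s t≤j) (t≢c ∘ suc-injective)

peak⇒∤sumFrom : ∀ {g i len e} (w : ℕ → ℕ) → Peak g i (i + len) e →
  (∀ t → i ≤ t → t ≤ i + len → w t % 2 ≡ 1) → ¬ 2 ^ suc e ∣ sumFrom (λ t → w t * g t) i len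
peak⇒∤sumFrom {g} {i} {len} {e} w (peak c i≤c c≤ gc≡ elsewhere) w-odd =
  ∤-sumFrom (2 ^ suc e) (λ t → w t * g t) c i len i≤c c≤
    (λ t i≤t t≤ t≢c → ∣n⇒∣m*n (w t) (elsewhere t i≤t t≤ t≢c))
    (2^[1+e]∤odd*2^e (w c) e (w-odd c i≤c c≤) ∘ subst (λ v → 2 ^ suc e ∣ w c * v) gc≡)

-- ruler R p = 2^(R-1-v₂(p)) for 0 < p < 2^R.
ruler : ℕ → ℕ → ℕ
ruler zero p = 0
ruler (suc R) p with <-cmp p (2 ^ R)
... | tri< _ _ _ = 2 * ruler R p
... | tri≈ _ _ _ = 1
... | tri> _ _ _ = 2 * ruler R (p ∸ 2 ^ R)

ruler-left : ∀ R {p} → p < 2 ^ R → ruler (suc R) p ≡ 2 * ruler R p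
ruler-left R {p} p<h with <-cmp p (2 ^ R)
... | tri< _ _ _ = refl
... | tri≈ _ p≡h _ = contradiction p≡h (<⇒≢ p<h)
... | tri> _ _ h<p = contradiction h<p (<⇒≯ p<h)

ruler-centre : ∀ R → ruler (suc R) (2 ^ R) ≡ 1
ruler-centre R with <-cmp (2 ^ R) (2 ^ R)
... | tri< h<h _ _ = contradiction h<h (<-irrefl refl)
... | tri≈ _ _ _ = refl
... | tri> _ _ h>h = contradiction h>h (<-irrefl refl)

ruler-right : ∀ R {p} → 2 ^ R < p → ruler (suc R) p ≡ 2 * ruler R (p ∸ 2 ^ R)
ruler-right R {p} h<p with <-cmp p (2 ^ R)
... | tri< p<h _ _ = contradiction h<p (<⇒≯ p<h)
... | tri≈ _ p≡h _ = contradiction (sym p≡h) (<⇒≢ h<p)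
... | tri> _ _ _ = refl

ruler-even : ∀ R {p} → p ≢ 2 ^ R → 2 ∣ ruler (suc R) p
ruler-even R {p} p≢h with <-cmp p (2 ^ R)
... | tri< _ _ _ = m∣m*n (ruler R p)
... | tri≈ _ p≡h _ = contradiction p≡h p≢h
... | tri> _ _ _ = m∣m*n (ruler R (p ∸ 2 ^ R))

ruler-< : ∀ R p → ruler R p < 2 ^ R
ruler-< zero p = z<s
ruler-< (suc R) p with <-cmp p (2 ^ R)
... | tri< _ _ _ = *-monoʳ-< 2 (ruler-< R p)
... | tri≈ _ _ _ = ^-monoʳ-< 2 (s≤s (s≤s z≤n)) {0} {suc R} z<s
... | tri> _ _ _ = *-monoʳ-< 2 (ruler-< R (p ∸ 2 ^ R))

ruler-peak : ∀ R {i j} → 1 ≤ i → i ≤ j → j < 2 ^ R → ∃[ e ] e < R × Peak (ruler R) i j e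
ruler-peak zero 1≤i i≤j (s≤s j≤0) = contradiction (≤-trans 1≤i (≤-trans i≤j j≤0)) λ ()
ruler-peak (suc R) {i} {j} 1≤i i≤j j<2h with j <? 2 ^ R | i ≤? 2 ^ R
... | yes j<h | _ with ruler-peak R 1≤i i≤j j<h
...   | e , e<R , pk =
  suc e , s<s e<R , peak-double (λ t _ t≤j → ruler-left R (≤-<-trans t≤j j<h)) pk
ruler-peak (suc R) {i} {j} 1≤i i≤j j<2h | no j≮h | yes i≤h =
  0 , z<s , peak (2 ^ R) i≤h (≮⇒≥ j≮h) (ruler-centre R) λ _ _ _ → ruler-even R
ruler-peak (suc R) {i} {j} 1≤i i≤j j<2h | no j≮h | no i≰h
  with ruler-peak R {i ∸ h} {j ∸ h} 1≤i∸h (∸-monoˡ-≤ h i≤j) j∸h<h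
  where
  h = 2 ^ R
  1≤i∸h : 1 ≤ i ∸ h
  1≤i∸h = m<n⇒0<n∸m (≰⇒> i≰h)
  j∸h<h : j ∸ h < h
  j∸h<h = +-cancelʳ-< h (j ∸ h) h
    (subst₂ _<_ (sym (m∸n+n≡m (≮⇒≥ j≮h))) (cong (h +_) (+-identityʳ h)) j<2h)
... | e , e<R , pk = suc e , s<s e<R ,
  peak-double (λ t i≤t _ → ruler-right R (<-≤-trans (≰⇒> i≰h) i≤t))
    (subst₂ (λ a b → Peak (λ t → ruler R (t ∸ 2 ^ R)) a b e)
      (m∸n+n≡m (<⇒≤ (≰⇒> i≰h))) (m∸n+n≡m (≮⇒≥ j≮h)) (peak-shift (2 ^ R) pk))

rulerSequence : ∀ {k n} r → 2 ^ r ≤ n → Fin k → Fin n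
rulerSequence r 2^r≤n t = fromℕ< (<-≤-trans (ruler-< r (suc (toℕ t))) 2^r≤n)

at-rulerSequence : ∀ {k n} r (2^r≤n : 2 ^ r ≤ n) {t} (t<k : t < k) →
  at (rulerSequence {k} r 2^r≤n) t ≡ ruler r (suc t)
at-rulerSequence r 2^r≤n t<k =
  trans (at-< (rulerSequence r 2^r≤n) t<k)
    (trans (toℕ-fromℕ< _) (cong (ruler r ∘ suc) (toℕ-fromℕ< t<k)))

lowerBound : ∀ n .{{_ : NonZero n}} r → 2 ^ r ∣ n → (A : Subset n) → (∀ x → A x → OddElem x) →
  ∀ k → AllHave n A k → 2 ^ r ≤ k
lowerBound n r 2^r∣n A A-odd k allHave with 2 ^ r ≤? k
... | yes 2^r≤k = 2^r≤k
... | no 2^r≰k with allHave (rulerSequence {k} r (∣⇒≤ 2^r∣n))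
...   | i , len , i+len<k , a , a∈A , sum%n≡0
  with ruler-peak r {suc i} {suc (i + len)} (s≤s z≤n) (s≤s (m≤m+n i len))
         (≤-<-trans i+len<k (≰⇒> 2^r≰k))
...   | e , e<r , pk = contradiction 2^[1+e]∣sum (peak⇒∤sumFrom (at a) (peak-pred pk) a-odd)
  where
  a-odd : ∀ t → i ≤ t → t ≤ i + len → at a t % 2 ≡ 1
  a-odd t i≤t t≤ = subst (λ v → v % 2 ≡ 1) (sym (at-< a t<k))
    (A-odd _ (a∈A (fromℕ< t<k) (subst (i ≤_) (sym (toℕ-fromℕ< t<k)) i≤t)
                               (subst (_≤ i + len) (sym (toℕ-fromℕ< t<k)) t≤)))
    where t<k = ≤-<-trans t≤ i+len<k
  sum≡ : sumFrom (λ t → at a t * at (rulerSequence {k} r (∣⇒≤ 2^r∣n)) t) i len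
       ≡ sumFrom (λ t → at a t * ruler r (suc t)) i len
  sum≡ = sumFrom-cong _ _ i len λ t _ t≤ →
    cong (at a t *_) (at-rulerSequence r (∣⇒≤ 2^r∣n) (≤-<-trans t≤ i+len<k))
  2^[1+e]∣sum : 2 ^ suc e ∣ sumFrom (λ t → at a t * ruler r (suc t)) i len
  2^[1+e]∣sum = ∣-trans (^-monoʳ-∣ 2 e<r)
    (∣-trans 2^r∣n (subst (n ∣_) sum≡ (m%n≡0⇒n∣m _ n sum%n≡0)))

mainTheorem3 : (n : ℕ) .{{_ : NonZero n}} → n % 2 ≡ 0 →
    (r m : ℕ) → V2 n r → n ≡ 2 ^ r * m →
    (A : Subset n) →
    ((x : Fin n) → toℕ x ≡ m → A x) →
    ((x : Fin n) → A x → OddElem x) →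
    IsCA n A (2 ^ r)
mainTheorem3 n n-even zero m (_ , 2∤n) _ _ _ _ = contradiction (m%n≡0⇒n∣m n 2 n-even) 2∤n
mainTheorem3 n _ r@(suc _) m _ n≡2^r*m A m∈A A-odd =
  m^n>0 2 r ,
  allHave-constantWeight n A (fromℕ< m<n) (m∈A _ (toℕ-fromℕ< m<n)) (2 ^ r)
    (subst (λ v → n ∣ v * 2 ^ r) (sym (toℕ-fromℕ< m<n)) (∣-reflexive n≡m*2^r)) ,
  λ k _ → lowerBound n r (divides m n≡m*2^r) A A-odd k
  where
  n≡m*2^r : n ≡ m * 2 ^ r
  n≡m*2^r = trans n≡2^r*m (*-comm (2 ^ r) m)
  instance
    _ : NonZero (2 ^ r)
    _ = m^n≢0 2 r
    _ : NonZero m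
    _ = ≢-nonZero λ m≡0 →
      ≢-nonZero⁻¹ n (trans n≡2^r*m (trans (cong (2 ^ r *_) m≡0) (*-zeroʳ (2 ^ r))))
  m<n : m < n
  m<n = subst (m <_) (sym n≡m*2^r)
    (m<m*n m (2 ^ r) (^-monoʳ-< 2 (s≤s (s≤s z≤n)) {0} {r} z<s))
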